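{- Let $k$ be a nonnegative integer, let $G=(V,E)$ be a connected graph and let $X\subseteq V$. If there exists a minimum $k$-forcing set of $\widehat X$ that contains only vertices in $X$, then \[Z_k(G/X)+Z_k(\widehat X)\geq Z_k(G)\geq \begin{cases} Z_k(G/X)-1 & \text{if } |N_G[X]\setminus X|\leq k,\\ Z_k(G/X)-|N_G[X]\setminus X|+k & \text{if } |N_G[X]\setminus X|>k.\end{cases}\]
   Context: Graphs are finite, simple and undirected; $N_G(v)$ is the open neighborhood and $N_G[S]=\bigcup_{v\in S}(N_G(v)\cup\{v\})$. For $X\subseteq V$, the contraction $G/X$ is the graph obtained from $G-X$ by adding a new vertex $v_X$ with $N_{G/X}(v_X)=N_G[X]\setminus X$ ($G[X]$ need not be connected). $\widehat X$ is the graph obtained from the induced subgraph $G[X]$ by attaching to each vertex $x\in X$ as many new pendent vertices as $x$ has neighbors in $G-X$. For a graph $G=(V,E)$, nonnegative integer $k$ and $T\subseteq V$, define $\mathscr F^0_{G,k}(T)=T$ and $\mathscr F^{i+1}_{G,k}(T)=\mathscr F^i_{G,k}(T)\cup\bigcup\{N(v): v\in \mathscr F^i_{G,k}(T),\ 1\le |N(v)\setminus \mathscr F^i_{G,k}(T)|\le k\}$. $T$ is a $k$-forcing set of $G$ if $\mathscr F^t_{G,k}(T)=V$ for some $t$; $Z_k(G)$ is the minimum size of a $k$-forcing set, and a minimum $k$-forcing set is one of that size. -}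

module Defs where

open import Data.Nat using (ℕ; zero; suc; _+_; _*_; _≤ᵇ_; _≤_)
open import Data.Bool using (Bool; true; false; _∧_; _∨_; not; T)
open import Data.Fin using (Fin; zero; suc; splitAt; remQuot; _≟_)
open import Data.Fin.Subset using (Subset; _∈_; _⊆_; ∁; _∩_; ∣_∣)
open import Data.Vec using (tabulate; lookup)
open import Data.List using (List; allFin)
open import Data.Bool.ListAction using (any)
open import Data.Sum using (_⊎_; inj₁; inj₂)
open import Data.Product using (_×_; _,_; ∃; ∃-syntax)
open import Relation.Nullary.Decidable using (⌊_⌋)
open import Relation.Binary.PropositionalEquality using (_≡_)
open import Relation.Binary.Construct.Closure.ReflexiveTransitive using (Star)

-- A graph is given on a "host" set Fin m: a vertex set vs ⊆ Fin m and a
-- Boolean adjacency relation (all edges lie inside vs for the constructions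
-- below).
record Graph (m : ℕ) : Set where
  constructor graph
  field
    vs  : Subset m
    adj : Fin m → Fin m → Bool
open Graph public

full : ∀ {n} → (Fin n → Fin n → Bool) → Graph n
full {n} a = graph (tabulate (λ _ → true)) a

IsSimple : ∀ {n} → (Fin n → Fin n → Bool) → Set
IsSimple a = (∀ u v → a u v ≡ a v u) × (∀ v → a v v ≡ false)

Connected : ∀ {n} → (Fin n → Fin n → Bool) → Set
Connected a = ∀ u v → Star (λ x y → T (a x y)) u v

anyFin : ∀ {m} → (Fin m → Bool) → Bool
anyFin {m} p = any p (allFin m)

N : ∀ {m} → Graph m → Fin m → Subset m
N G v = tabulate (adj G v)

forceStep : ∀ {m} → Graph m → ℕ → Subset m → Subset m
forceStep G k F = tabulate λ u → lookup F u ∨ anyFin (λ v → cond v ∧ adj G v u)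
  where
    cond : _ → Bool
    cond v = lookup F v ∧ (1 ≤ᵇ ∣ N G v ∩ ∁ F ∣) ∧ (∣ N G v ∩ ∁ F ∣ ≤ᵇ k)

𝓕 : ∀ {m} → Graph m → ℕ → ℕ → Subset m → Subset m
𝓕 G k zero    T = T
𝓕 G k (suc t) T = forceStep G k (𝓕 G k t T)

IsForcing : ∀ {m} → Graph m → ℕ → Subset m → Set
IsForcing G k T = T ⊆ vs G × ∃[ t ] (vs G ⊆ 𝓕 G k t T)

IsMinForcing : ∀ {m} → Graph m → ℕ → Subset m → Set
IsMinForcing G k T = IsForcing G k T × (∀ T' → IsForcing G k T' → ∣ T ∣ ≤ ∣ T' ∣)

IsZ : ∀ {m} → Graph m → ℕ → ℕ → Set
IsZ G k z = ∃[ T ] (IsMinForcing G k T × ∣ T ∣ ≡ z)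

module _ {n : ℕ} (a : Fin n → Fin n → Bool) (X : Subset n) where

  inBoundary : Fin n → Bool
  inBoundary w = not (lookup X w) ∧ anyFin (λ x → lookup X x ∧ a x w)

  boundary : Subset n
  boundary = tabulate inBoundary

  -- G / X on host Fin (suc n): zero is v_X, suc v is v (for v ∉ X)
  contrAdj : Fin (suc n) → Fin (suc n) → Bool
  contrAdj zero    zero    = false
  contrAdj zero    (suc w) = inBoundary w
  contrAdj (suc v) zero    = inBoundary v
  contrAdj (suc v) (suc w) = not (lookup X v) ∧ not (lookup X w) ∧ a v w

  contrVs : Fin (suc n) → Bool
  contrVs zero    = true
  contrVs (suc v) = not (lookup X v)

  contraction : Graph (suc n)
  contraction = graph (tabulate contrVs) contrAdj

  -- \hat X on host Fin (n + n * n): inj₁ x is x ∈ X, inj₂ (x , y) is the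
  -- pendant vertex attached to x ∈ X for the edge xy with y ∉ X.
  HatV : Set
  HatV = Fin n ⊎ (Fin n × Fin n)

  decode : Fin (n + n * n) → HatV
  decode i with splitAt n i
  ... | inj₁ x = inj₁ x
  ... | inj₂ p = inj₂ (remQuot n p)

  hatVs' : HatV → Bool
  hatVs' (inj₁ x)       = lookup X x
  hatVs' (inj₂ (x , y)) = lookup X x ∧ not (lookup X y) ∧ a x y

  hatAdj' : HatV → HatV → Bool
  hatAdj' (inj₁ x) (inj₁ x')       = lookup X x ∧ lookup X x' ∧ a x x'
  hatAdj' (inj₁ x) (inj₂ (x' , y)) = ⌊ x ≟ x' ⌋ ∧ hatVs' (inj₂ (x' , y))
  hatAdj' (inj₂ (x' , y)) (inj₁ x) = ⌊ x ≟ x' ⌋ ∧ hatVs' (inj₂ (x' , y))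
  hatAdj' (inj₂ _) (inj₂ _)        = false

  hat : Graph (n + n * n)
  hat = graph (tabulate (λ i → hatVs' (decode i))) (λ i j → hatAdj' (decode i) (decode j))

  IsOriginal : Fin (n + n * n) → Set
  IsOriginal i = ∃[ x ] (decode i ≡ inj₁ x)

-- Both bounds compare forcing processes on different graphs, step by step.
-- Upper bound: a k-forcing set of G/X (without v_X) together with a k-forcing set of X̂
-- lying in X is a k-forcing set of G. The X̂-process is mirrored in G, reading a pendant
-- vertex as the outer end of its edge; a vertex of X has in G no more uncoloured
-- neighbours than in X̂, so it can force there too. Once X̂ is coloured all of N_G[X] is,
-- and from then on the G/X-process is mirrored in G.
-- Lower bound: from a k-forcing set T of G, replace T ∩ X by v_X and add all but k
-- vertices of the boundary N_G[X] ∖ X. Then v_X has at most k uncoloured neighbours, so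
-- as soon as a vertex of X is coloured the whole boundary follows, and each step of G is
-- mirrored by two steps of G/X. Adding v_X only when T meets X (or X = ∅) gives the
-- sharper bound when the boundary has more than k vertices.

module Submission where

open import Defs
open import Data.Nat using (ℕ; zero; suc; _+_; _*_; _∸_; _≤_; _<_; _>_; z≤n; s≤s; _≤ᵇ_)
open import Data.Nat.Properties
  using (>⇒≢; ≤-refl; ≤-reflexive; ≤-trans; module ≤-Reasoning; +-identityʳ; +-comm; +-assoc;
         m≤n⇒m∸n≡0; m∸n+n≡m; <⇒≤; n≤1+n; +-suc; +-mono-≤; +-monoʳ-≤; +-monoˡ-≤; ≤ᵇ⇒≤; ≤⇒≤ᵇ)
open import Data.Bool using (Bool; true; false; _∧_; _∨_; not)
open import Data.Bool.Properties using (T-≡)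
open import Data.Fin using (Fin; zero; suc; _≟_; _↑ˡ_; _↑ʳ_; combine; remQuot; splitAt)
open import Data.Fin.Properties
  using (suc-injective; 0≢1+n; ↑ˡ-injective; splitAt-↑ˡ; splitAt-↑ʳ; splitAt⁻¹-↑ˡ; splitAt⁻¹-↑ʳ; remQuot-combine; combine-remQuot)
open import Data.Fin.Subset using (Subset; Nonempty; Empty; inside; outside; _∈_; _∉_; _⊆_; ∁; _∩_; _∪_; _─_; _-_; ∣_∣)
open import Data.Fin.Subset.Properties
  using (_∈?_; nonempty?; Empty-unique; ∣⊥∣≡0; p⊆q⇒∣p∣≤∣q∣; ∣p─q∣≤∣p∣; p∩q≢∅⇒∣p─q∣<∣p∣;
         x∈p∧x∉q⇒x∈p─q; x∈p∪q⁻; x∈p∪q⁺; x∈p∩q⁺; x∈p∩q⁻; x∈∁p⇒x∉p; x∉p⇒x∈∁p; x∈p∧x≢y⇒x∈p-y; x∈p⇒∣p-x∣<∣p∣)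
open import Data.Vec using ([]; _∷_; here; there; tabulate; lookup)
open import Data.Vec.Properties using (lookup∘tabulate; []=⇒lookup; lookup⇒[]=)
open import Data.List using (allFin)
open import Data.List.Membership.Propositional using (lose; find)
open import Data.List.Membership.Propositional.Properties using (∈-allFin)
open import Data.List.Relation.Unary.Any.Properties using (any⁺; any⁻)
open import Data.Sum using (_⊎_; inj₁; inj₂; [_,_]′)
open import Data.Product using (_×_; _,_; ∃-syntax; proj₁; proj₂)
open import Function using (_∘_; id; Injective)
open import Function.Bundles using (Equivalence)
open import Relation.Nullary using (¬_; yes; no; contradiction)
open import Relation.Nullary.Decidable using (⌊_⌋; toWitness; fromWitness)
open import Relation.Binary.PropositionalEquality using (_≡_; refl; sym; trans; cong; subst)

open Equivalence using (to; from)

private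
  variable
    m m' : ℕ

∧-true⁻ : ∀ x {y} → x ∧ y ≡ true → x ≡ true × y ≡ true
∧-true⁻ true y≡true = refl , y≡true

∧-true⁺ : ∀ {x y} → x ≡ true → y ≡ true → x ∧ y ≡ true
∧-true⁺ refl y≡true = y≡true

∨-true⁻ : ∀ x {y} → x ∨ y ≡ true → x ≡ true ⊎ y ≡ true
∨-true⁻ true  _        = inj₁ refl
∨-true⁻ false y≡true = inj₂ y≡true

∨-true⁺ˡ : ∀ {x} y → x ≡ true → x ∨ y ≡ true
∨-true⁺ˡ _ refl = refl

∨-true⁺ʳ : ∀ x {y} → y ≡ true → x ∨ y ≡ true
∨-true⁺ʳ true  _        = refl
∨-true⁺ʳ false y≡true = y≡true

∈⇒lookup : ∀ {p : Subset m} {x} → x ∈ p → lookup p x ≡ true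
∈⇒lookup = []=⇒lookup

lookup⇒∈ : ∀ {p : Subset m} {x} → lookup p x ≡ true → x ∈ p
lookup⇒∈ {p = p} {x} = lookup⇒[]= x p

∉⇒not-lookup : ∀ {p : Subset m} {x} → x ∉ p → not (lookup p x) ≡ true
∉⇒not-lookup {p = p} {x} x∉p with lookup p x in eq
... | true  = contradiction (lookup⇒∈ eq) x∉p
... | false = refl

not-lookup⇒∉ : ∀ {p : Subset m} {x} → not (lookup p x) ≡ true → x ∉ p
not-lookup⇒∉ {p = p} {x} e x∈p with lookup p x | ∈⇒lookup x∈p
not-lookup⇒∉ () x∈p | true | refl

∈-tabulate⁺ : ∀ {f : Fin m → Bool} {x} → f x ≡ true → x ∈ tabulate f
∈-tabulate⁺ {f = f} {x} fx = lookup⇒∈ (trans (lookup∘tabulate f x) fx)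

∈-tabulate⁻ : ∀ {f : Fin m → Bool} {x} → x ∈ tabulate f → f x ≡ true
∈-tabulate⁻ {f = f} {x} x∈ = trans (sym (lookup∘tabulate f x)) (∈⇒lookup x∈)

anyFin⁺ : ∀ (p : Fin m → Bool) {x} → p x ≡ true → anyFin p ≡ true
anyFin⁺ p {x} px = to T-≡ (any⁺ p (lose (∈-allFin x) (from T-≡ px)))

anyFin⁻ : ∀ (p : Fin m → Bool) → anyFin p ≡ true → ∃[ x ] p x ≡ true
anyFin⁻ p e with find (any⁻ p (allFin _) (from T-≡ e))
... | x , _ , px = x , to T-≡ px

∣p∣≤∣q∣-injection : ∀ (f : Fin m → Fin m') {p q} → (∀ {i} → i ∈ p → f i ∈ q) →
  (∀ {i j} → i ∈ p → j ∈ p → f i ≡ f j → i ≡ j) → ∣ p ∣ ≤ ∣ q ∣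
∣p∣≤∣q∣-injection f {[]}          maps inj = z≤n
∣p∣≤∣q∣-injection f {outside ∷ p} maps inj =
  ∣p∣≤∣q∣-injection (f ∘ suc) (maps ∘ there) (λ i j e → suc-injective (inj (there i) (there j) e))
∣p∣≤∣q∣-injection f {inside ∷ p} {q} maps inj = ≤-trans (s≤s rest) (x∈p⇒∣p-x∣<∣p∣ (maps here))
  where
  rest : ∣ p ∣ ≤ ∣ q - f zero ∣
  rest = ∣p∣≤∣q∣-injection (f ∘ suc)
    (λ i∈p → x∈p∧x≢y⇒x∈p-y (maps (there i∈p)) (λ e → 0≢1+n (sym (inj (there i∈p) here e))))
    (λ i j e → suc-injective (inj (there i) (there j) e))

∣p∪q∣≤∣p∣+∣q∣ : ∀ (p q : Subset m) → ∣ p ∪ q ∣ ≤ ∣ p ∣ + ∣ q ∣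
∣p∪q∣≤∣p∣+∣q∣ []            []            = z≤n
∣p∪q∣≤∣p∣+∣q∣ (outside ∷ p) (outside ∷ q) = ∣p∪q∣≤∣p∣+∣q∣ p q
∣p∪q∣≤∣p∣+∣q∣ (outside ∷ p) (inside  ∷ q) =
  subst (suc ∣ p ∪ q ∣ ≤_) (sym (+-suc ∣ p ∣ ∣ q ∣)) (s≤s (∣p∪q∣≤∣p∣+∣q∣ p q))
∣p∪q∣≤∣p∣+∣q∣ (inside  ∷ p) (outside ∷ q) = s≤s (∣p∪q∣≤∣p∣+∣q∣ p q)
∣p∪q∣≤∣p∣+∣q∣ (inside  ∷ p) (inside  ∷ q) =
  s≤s (≤-trans (∣p∪q∣≤∣p∣+∣q∣ p q) (+-monoʳ-≤ ∣ p ∣ (n≤1+n ∣ q ∣)))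

preimage : (Fin m → Fin m') → Subset m' → Subset m
preimage f q = tabulate (lookup q ∘ f)

∈-preimage⁺ : ∀ {f : Fin m → Fin m'} {q i} → f i ∈ q → i ∈ preimage f q
∈-preimage⁺ = ∈-tabulate⁺ ∘ ∈⇒lookup

∈-preimage⁻ : ∀ {f : Fin m → Fin m'} {q i} → i ∈ preimage f q → f i ∈ q
∈-preimage⁻ = lookup⇒∈ ∘ ∈-tabulate⁻

∣preimage∣≤ : ∀ {f : Fin m → Fin m'} {q} → Injective _≡_ _≡_ f → ∣ preimage f q ∣ ≤ ∣ q ∣
∣preimage∣≤ {f = f} {q} f-inj = ∣p∣≤∣q∣-injection f {preimage f q} {q} (∈-preimage⁻ {f = f}) (λ _ _ → f-inj)

∣p∣>0⇒Nonempty : ∀ (p : Subset m) → 0 < ∣ p ∣ → Nonempty p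
∣p∣>0⇒Nonempty {m} p 0<∣p∣ with nonempty? p
... | yes p≢∅ = p≢∅
... | no  p≡∅ = contradiction (trans (cong ∣_∣ (Empty-unique p≡∅)) (∣⊥∣≡0 m)) (>⇒≢ 0<∣p∣)

x∈p─q⇒x∉q : ∀ {p q : Subset m} {x} → x ∈ p ─ q → x ∉ q
x∈p─q⇒x∉q {p = inside ∷ p} {outside ∷ q} here       = λ ()
x∈p─q⇒x∉q {p = _ ∷ p}      {_ ∷ q}       (there x∈) (there x∈q) = x∈p─q⇒x∉q x∈ x∈q

∣p─p∣≡0 : ∀ (p : Subset m) → ∣ p ─ p ∣ ≡ 0
∣p─p∣≡0 []            = refl
∣p─p∣≡0 (inside  ∷ p) = ∣p─p∣≡0 p
∣p─p∣≡0 (outside ∷ p) = ∣p─p∣≡0 p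

withoutFirst : ℕ → Subset m → Subset m
withoutFirst zero    p             = p
withoutFirst (suc k) []            = []
withoutFirst (suc k) (inside  ∷ p) = outside ∷ withoutFirst k p
withoutFirst (suc k) (outside ∷ p) = outside ∷ withoutFirst (suc k) p

withoutFirst⊆ : ∀ k (p : Subset m) → withoutFirst k p ⊆ p
withoutFirst⊆ zero    p             x∈         = x∈
withoutFirst⊆ (suc k) (inside  ∷ p) (there x∈) = there (withoutFirst⊆ k p x∈)
withoutFirst⊆ (suc k) (outside ∷ p) (there x∈) = there (withoutFirst⊆ (suc k) p x∈)

∣withoutFirst∣≤∣p∣∸k : ∀ k (p : Subset m) → ∣ withoutFirst k p ∣ ≤ ∣ p ∣ ∸ k
∣withoutFirst∣≤∣p∣∸k zero    p             = ≤-refl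
∣withoutFirst∣≤∣p∣∸k (suc k) []            = z≤n
∣withoutFirst∣≤∣p∣∸k (suc k) (inside  ∷ p) = ∣withoutFirst∣≤∣p∣∸k k p
∣withoutFirst∣≤∣p∣∸k (suc k) (outside ∷ p) = ∣withoutFirst∣≤∣p∣∸k (suc k) p

∣p─withoutFirst∣≤k : ∀ k (p : Subset m) → ∣ p ─ withoutFirst k p ∣ ≤ k
∣p─withoutFirst∣≤k zero    p             = ≤-reflexive (∣p─p∣≡0 p)
∣p─withoutFirst∣≤k (suc k) []            = z≤n
∣p─withoutFirst∣≤k (suc k) (inside  ∷ p) = s≤s (∣p─withoutFirst∣≤k k p)
∣p─withoutFirst∣≤k (suc k) (outside ∷ p) = ∣p─withoutFirst∣≤k (suc k) p

module _ (G : Graph m) where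

  ∈N∩∁⁺ : ∀ {F v u} → adj G v u ≡ true → u ∉ F → u ∈ N G v ∩ ∁ F
  ∈N∩∁⁺ avu u∉F = x∈p∩q⁺ (∈-tabulate⁺ avu , x∉p⇒x∈∁p u∉F)

  ∈N∩∁⁻ : ∀ {F v u} → u ∈ N G v ∩ ∁ F → adj G v u ≡ true × u ∉ F
  ∈N∩∁⁻ {F} {v} u∈ with x∈p∩q⁻ (N G v) (∁ F) u∈
  ... | u∈N , u∈∁F = ∈-tabulate⁻ u∈N , x∈∁p⇒x∉p u∈∁F

  module _ (k : ℕ) where

    CanForce : Subset m → Fin m → Set
    CanForce F v = v ∈ F × ∣ N G v ∩ ∁ F ∣ ≤ k

    -- the condition cond in the definition of forceStep
    private
      canForceᵇ : Subset m → Fin m → Bool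
      canForceᵇ F v = lookup F v ∧ (1 ≤ᵇ ∣ N G v ∩ ∁ F ∣) ∧ (∣ N G v ∩ ∁ F ∣ ≤ᵇ k)

    F⊆forceStep : ∀ {F} → F ⊆ forceStep G k F
    F⊆forceStep {F} {u} u∈F = ∈-tabulate⁺ (∨-true⁺ˡ _ (∈⇒lookup u∈F))

    forceStep-forces : ∀ {F v u} → CanForce F v → adj G v u ≡ true → u ∈ forceStep G k F
    forceStep-forces {F} {v} {u} (v∈F , few) avu with u ∈? F
    ... | yes u∈F = F⊆forceStep u∈F
    ... | no  u∉F = ∈-tabulate⁺ (∨-true⁺ʳ (lookup F u) (anyFin⁺ (λ w → canForceᵇ F w ∧ adj G w u) (∧-true⁺ v-can-force avu)))
      where
      one≤uncoloured : 1 ≤ ∣ N G v ∩ ∁ F ∣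
      one≤uncoloured = ≤-trans (s≤s z≤n) (x∈p⇒∣p-x∣<∣p∣ (∈N∩∁⁺ avu u∉F))
      v-can-force : canForceᵇ F v ≡ true
      v-can-force = ∧-true⁺ (∈⇒lookup v∈F) (∧-true⁺ (to T-≡ (≤⇒≤ᵇ one≤uncoloured)) (to T-≡ (≤⇒≤ᵇ few)))

    forceStep⁻ : ∀ {F u} → u ∈ forceStep G k F → u ∈ F ⊎ ∃[ v ] (CanForce F v × adj G v u ≡ true)
    forceStep⁻ {F} {u} u∈ with ∨-true⁻ (lookup F u) (∈-tabulate⁻ u∈)
    ... | inj₁ u∈F = inj₁ (lookup⇒∈ u∈F)
    ... | inj₂ forced with anyFin⁻ (λ w → canForceᵇ F w ∧ adj G w u) forced
    ... | v , v-forces-u with ∧-true⁻ (canForceᵇ F v) v-forces-u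
    ... | v-can-force , avu with ∧-true⁻ (lookup F v) v-can-force
    ... | v∈F , bounds =
      inj₂ (v , (lookup⇒∈ v∈F , ≤ᵇ⇒≤ _ k (from T-≡ (proj₂ (∧-true⁻ (1 ≤ᵇ ∣ N G v ∩ ∁ F ∣) bounds)))) , avu)

    T⊆𝓕 : ∀ {T} t → T ⊆ 𝓕 G k t T
    T⊆𝓕 zero    u∈T = u∈T
    T⊆𝓕 (suc t) u∈T = F⊆forceStep (T⊆𝓕 t u∈T)

    𝓕-+ : ∀ {T} j s → 𝓕 G k j (𝓕 G k s T) ≡ 𝓕 G k (j + s) T
    𝓕-+ zero    s = refl
    𝓕-+ (suc j) s = cong (forceStep G k) (𝓕-+ j s)

∣N∩∁∣≤-injection : ∀ (G : Graph m) (G' : Graph m') {F F' v v'} (f : Fin m → Fin m') →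
  (∀ {u} → adj G v u ≡ true → u ∉ F → adj G' v' (f u) ≡ true × f u ∉ F') →
  (∀ {u w} → adj G v u ≡ true → adj G v w ≡ true → f u ≡ f w → u ≡ w) →
  ∣ N G v ∩ ∁ F ∣ ≤ ∣ N G' v' ∩ ∁ F' ∣
∣N∩∁∣≤-injection G G' f maps inj = ∣p∣≤∣q∣-injection f
  (λ u∈ → let (avu , u∉F) = ∈N∩∁⁻ G u∈ ; (a'fu , fu∉F') = maps avu u∉F in ∈N∩∁⁺ G' a'fu fu∉F')
  (λ u∈ w∈ → inj (proj₁ (∈N∩∁⁻ G u∈)) (proj₁ (∈N∩∁⁻ G w∈)))

𝓕-simulation : ∀ {G : Graph m} {G' : Graph m'} {k T T'} (R : Subset m → Subset m' → Set) c j →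
  R T (𝓕 G' k c T') → (∀ {F F'} → R F F' → R (forceStep G k F) (𝓕 G' k j F')) →
  ∀ t → ∃[ s ] R (𝓕 G k t T) (𝓕 G' k s T')
𝓕-simulation R c j base step zero = c , base
𝓕-simulation {G' = G'} {k} R c j base step (suc t) with 𝓕-simulation R c j base step t
... | s , r = j + s , subst (R _) (𝓕-+ G' k j s) (step r)

-- The boundary N[X] ∖ X, the contraction G/X and the graph X̂

module _ {n} (a : Fin n → Fin n → Bool) (X : Subset n) where

  ∈boundary⁺ : ∀ {x w} → w ∉ X → x ∈ X → a x w ≡ true → w ∈ boundary a X
  ∈boundary⁺ w∉X x∈X axw =
    ∈-tabulate⁺ (∧-true⁺ (∉⇒not-lookup w∉X) (anyFin⁺ (λ x → lookup X x ∧ a x _) (∧-true⁺ (∈⇒lookup x∈X) axw)))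

  ∈boundary⁻ : ∀ {w} → w ∈ boundary a X → w ∉ X × ∃[ x ] (x ∈ X × a x w ≡ true)
  ∈boundary⁻ {w} w∈B with ∧-true⁻ (not (lookup X w)) (∈-tabulate⁻ w∈B)
  ... | w∉X , adjacent with anyFin⁻ (λ x → lookup X x ∧ a x w) adjacent
  ... | x , x∈X∧axw with ∧-true⁻ (lookup X x) x∈X∧axw
  ... | x∈X , axw = not-lookup⇒∉ w∉X , x , lookup⇒∈ x∈X , axw

  outside∈contraction : ∀ {v} → v ∉ X → suc v ∈ vs (contraction a X)
  outside∈contraction {v} v∉X = ∈-tabulate⁺ {f = contrVs a X} {x = suc v} (∉⇒not-lookup v∉X)

  outside∈contraction⁻ : ∀ {v} → suc v ∈ vs (contraction a X) → v ∉ X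
  outside∈contraction⁻ {v} v∈ = not-lookup⇒∉ (∈-tabulate⁻ {f = contrVs a X} {x = suc v} v∈)

  adj-contraction⁺ : ∀ {v w} → v ∉ X → w ∉ X → a v w ≡ true → adj (contraction a X) (suc v) (suc w) ≡ true
  adj-contraction⁺ v∉X w∉X avw = ∧-true⁺ (∉⇒not-lookup v∉X) (∧-true⁺ (∉⇒not-lookup w∉X) avw)

  adj-contraction⁻ : ∀ {v w} → adj (contraction a X) (suc v) (suc w) ≡ true → v ∉ X × w ∉ X × a v w ≡ true
  adj-contraction⁻ {v} {w} e with ∧-true⁻ (not (lookup X v)) e
  ... | v∉X , rest with ∧-true⁻ (not (lookup X w)) rest
  ... | w∉X , avw = not-lookup⇒∉ v∉X , not-lookup⇒∉ w∉X , avw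

  boundary-nonempty⇒X-nonempty : Nonempty (boundary a X) → Nonempty X
  boundary-nonempty⇒X-nonempty (_ , w∈B) with ∈boundary⁻ w∈B
  ... | _ , x , x∈X , _ = x , x∈X

  original : Fin n → Fin (n + n * n)
  original x = x ↑ˡ n * n

  pendant : Fin n → Fin n → Fin (n + n * n)
  pendant x y = n ↑ʳ combine x y

  decode-original : ∀ x → decode a X (original x) ≡ inj₁ x
  decode-original x rewrite splitAt-↑ˡ n x (n * n) = refl

  decode-pendant : ∀ x y → decode a X (pendant x y) ≡ inj₂ (x , y)
  decode-pendant x y rewrite splitAt-↑ʳ n (n * n) (combine x y) | remQuot-combine {n} {n} x y = refl

  data HatVertex : Fin (n + n * n) → Set where
    original-vertex : ∀ x   → HatVertex (original x)
    pendant-vertex  : ∀ x y → HatVertex (pendant x y)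

  hatVertex : ∀ i → HatVertex i
  hatVertex i with splitAt n i in eq
  ... | inj₁ x = subst HatVertex (splitAt⁻¹-↑ˡ eq) (original-vertex x)
  ... | inj₂ j = subst HatVertex (trans (cong (n ↑ʳ_) (combine-remQuot {n} n j)) (splitAt⁻¹-↑ʳ eq))
                   (pendant-vertex (proj₁ (remQuot {n} n j)) (proj₂ (remQuot {n} n j)))

  pendant-not-original : ∀ {x y} → ¬ IsOriginal a X (pendant x y)
  pendant-not-original {x} {y} (x' , decoded) with trans (sym (decode-pendant x y)) decoded
  ... | ()

  -- the vertex of G that a vertex of X̂ stands for: x for x, and y for the pendant of the edge xy
  toG : Fin (n + n * n) → Fin n
  toG i = [ id , proj₂ ]′ (decode a X i)

  toG-original : ∀ x → toG (original x) ≡ x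
  toG-original x = cong [ id , proj₂ ]′ (decode-original x)

  toG-pendant : ∀ x y → toG (pendant x y) ≡ y
  toG-pendant x y = cong [ id , proj₂ ]′ (decode-pendant x y)

  hat-adj : ∀ {i j p q} → decode a X i ≡ p → decode a X j ≡ q → adj (hat a X) i j ≡ hatAdj' a X p q
  hat-adj refl refl = refl

  original∈hat : ∀ {x} → x ∈ X → original x ∈ vs (hat a X)
  original∈hat {x} x∈X = ∈-tabulate⁺ (trans (cong (hatVs' a X) (decode-original x)) (∈⇒lookup x∈X))

  pendant∈hat : ∀ {x y} → x ∈ X → y ∉ X → a x y ≡ true → pendant x y ∈ vs (hat a X)
  pendant∈hat {x} {y} x∈X y∉X axy = ∈-tabulate⁺ (trans (cong (hatVs' a X) (decode-pendant x y))
    (∧-true⁺ (∈⇒lookup x∈X) (∧-true⁺ (∉⇒not-lookup y∉X) axy)))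

  adj-original⁻ : ∀ {x i} → adj (hat a X) (original x) i ≡ true → x ∈ X × a x (toG i) ≡ true
  adj-original⁻ {x} {i} e with hatVertex i
  ... | original-vertex x'
    with ∧-true⁻ (lookup X x) (trans (sym (hat-adj (decode-original x) (decode-original x'))) e)
  ... | x∈X , x'∈X∧axx' = lookup⇒∈ x∈X ,
    subst (λ w → a x w ≡ true) (sym (toG-original x')) (proj₂ (∧-true⁻ (lookup X x') x'∈X∧axx'))
  adj-original⁻ {x} e | pendant-vertex x' y
    with ∧-true⁻ ⌊ x ≟ x' ⌋ (trans (sym (hat-adj (decode-original x) (decode-pendant x' y))) e)
  ... | x≟x' , rest with toWitness {a? = x ≟ x'} (from T-≡ x≟x')
  ... | refl with ∧-true⁻ (lookup X x) rest
  ... | x∈X , y∉X∧axy = lookup⇒∈ x∈X ,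
    subst (λ w → a x w ≡ true) (sym (toG-pendant x y)) (proj₂ (∧-true⁻ (not (lookup X y)) y∉X∧axy))

  adj-pendant⁻ : ∀ {x y i} → adj (hat a X) (pendant x y) i ≡ true → i ≡ original x
  adj-pendant⁻ {x} {y} {i} e with hatVertex i
  ... | original-vertex x'
    with ∧-true⁻ ⌊ x' ≟ x ⌋ (trans (sym (hat-adj (decode-pendant x y) (decode-original x'))) e)
  ... | x'≟x , _ = cong original (toWitness {a? = x' ≟ x} (from T-≡ x'≟x))
  adj-pendant⁻ {x} {y} e | pendant-vertex x' y'
    with trans (sym (hat-adj (decode-pendant x y) (decode-pendant x' y'))) e
  ... | ()

  adj-to-pendant⁻ : ∀ {x y i} → adj (hat a X) i (pendant x y) ≡ true → i ≡ original x
  adj-to-pendant⁻ {x} {y} {i} e with hatVertex i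
  ... | original-vertex x'
    with ∧-true⁻ ⌊ x' ≟ x ⌋ (trans (sym (hat-adj (decode-original x') (decode-pendant x y))) e)
  ... | x'≟x , _ = cong original (toWitness {a? = x' ≟ x} (from T-≡ x'≟x))
  adj-to-pendant⁻ {x} {y} e | pendant-vertex x' y'
    with trans (sym (hat-adj (decode-pendant x' y') (decode-pendant x y))) e
  ... | ()

  -- the neighbour of x in X̂ through which the edge xw of G passes
  hatNeighbour : Fin n → Fin n → Fin (n + n * n)
  hatNeighbour x w with w ∈? X
  ... | yes _ = original w
  ... | no  _ = pendant x w

  toG-hatNeighbour : ∀ x w → toG (hatNeighbour x w) ≡ w
  toG-hatNeighbour x w with w ∈? X
  ... | yes _ = toG-original w
  ... | no  _ = toG-pendant x w

  adj-hatNeighbour : ∀ {x w} → x ∈ X → a x w ≡ true → adj (hat a X) (original x) (hatNeighbour x w) ≡ true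
  adj-hatNeighbour {x} {w} x∈X axw with w ∈? X
  ... | yes w∈X = trans (hat-adj (decode-original x) (decode-original w))
                    (∧-true⁺ (∈⇒lookup x∈X) (∧-true⁺ (∈⇒lookup w∈X) axw))
  ... | no  w∉X = trans (hat-adj (decode-original x) (decode-pendant x w))
                    (∧-true⁺ (to T-≡ (fromWitness {a? = x ≟ x} refl))
                      (∧-true⁺ (∈⇒lookup x∈X) (∧-true⁺ (∉⇒not-lookup w∉X) axw)))

module UpperBound (k : ℕ) {n} (a : Fin n → Fin n → Bool) (X : Subset n) where

  G = full a
  C = contraction a X
  H = hat a X

  record HatShadow (FH : Subset (n + n * n)) (FG : Subset n) : Set where
    field
      hat-shadow : ∀ {i} → i ∈ FH → toG a X i ∈ FG
      attached   : ∀ {x y} → pendant a X x y ∈ FH → original a X x ∈ FH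
  open HatShadow

  uncoloured-hat≤ : ∀ {FH FG x} → HatShadow FH FG → x ∈ X →
    ∣ N G x ∩ ∁ FG ∣ ≤ ∣ N H (original a X x) ∩ ∁ FH ∣
  uncoloured-hat≤ {FG = FG} {x} sh x∈X = ∣N∩∁∣≤-injection G H (hatNeighbour a X x)
    (λ {w} axw w∉FG → adj-hatNeighbour a X x∈X axw ,
      λ w'∈FH → w∉FG (subst (_∈ FG) (toG-hatNeighbour a X x w) (hat-shadow sh w'∈FH)))
    (λ {u} {w} _ _ e → trans (sym (toG-hatNeighbour a X x u))
                         (trans (cong (toG a X) e) (toG-hatNeighbour a X x w)))

  hatShadow-step : ∀ {FH FG} → HatShadow FH FG → HatShadow (forceStep H k FH) (forceStep G k FG)
  hat-shadow (hatShadow-step {FG = FG} sh) i∈ with forceStep⁻ H k i∈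
  ... | inj₁ i∈FH = F⊆forceStep G k (hat-shadow sh i∈FH)
  ... | inj₂ (v , (v∈FH , few) , avi) with hatVertex a X v
  ... | original-vertex x with adj-original⁻ a X avi
  ...   | x∈X , ax[toG-i] = forceStep-forces G k (x∈FG , ≤-trans (uncoloured-hat≤ sh x∈X) few) ax[toG-i]
    where
    x∈FG : x ∈ FG
    x∈FG = subst (_∈ FG) (toG-original a X x) (hat-shadow sh v∈FH)
  hat-shadow (hatShadow-step sh) i∈ | inj₂ (v , (v∈FH , _) , avi) | pendant-vertex x y
    rewrite adj-pendant⁻ a X avi = F⊆forceStep G k (hat-shadow sh (attached sh v∈FH))
  attached (hatShadow-step sh) p∈ with forceStep⁻ H k p∈
  ... | inj₁ p∈FH = F⊆forceStep H k (attached sh p∈FH)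
  ... | inj₂ (v , (v∈FH , _) , avp) rewrite adj-to-pendant⁻ a X avp = F⊆forceStep H k v∈FH

  record ContractionShadow (F' : Subset (suc n)) (FG : Subset n) : Set where
    field
      contraction-shadow : ∀ {v} → suc v ∈ F' → v ∈ FG
      X⊆        : X ⊆ FG
      boundary⊆ : boundary a X ⊆ FG
  open ContractionShadow

  uncoloured-contraction≤ : ∀ {F' FG w} → ContractionShadow F' FG → w ∉ X →
    ∣ N G w ∩ ∁ FG ∣ ≤ ∣ N C (suc w) ∩ ∁ F' ∣
  uncoloured-contraction≤ {w = w} sh w∉X = ∣N∩∁∣≤-injection G C {v = w} {v' = suc w} suc
    (λ awu u∉FG → adj-contraction⁺ a X w∉X (u∉FG ∘ X⊆ sh) awu , u∉FG ∘ contraction-shadow sh)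
    (λ _ _ → suc-injective)

  contractionShadow-step : ∀ {F' FG} → ContractionShadow F' FG →
    ContractionShadow (forceStep C k F') (forceStep G k FG)
  contraction-shadow (contractionShadow-step sh) v∈ with forceStep⁻ C k v∈
  ... | inj₁ v∈F' = F⊆forceStep G k (contraction-shadow sh v∈F')
  ... | inj₂ (zero , _ , v∈B) = F⊆forceStep G k (boundary⊆ sh (∈-tabulate⁺ v∈B))
  ... | inj₂ (suc w , (w∈F' , few) , awv) with adj-contraction⁻ a X awv
  ...   | w∉X , _ , awv' =
    forceStep-forces G k (contraction-shadow sh w∈F' , ≤-trans (uncoloured-contraction≤ sh w∉X) few) awv'
  X⊆        (contractionShadow-step sh) = F⊆forceStep G k ∘ X⊆ sh
  boundary⊆ (contractionShadow-step sh) = F⊆forceStep G k ∘ boundary⊆ sh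

  upperBound : ∀ {TC TH} → IsForcing C k TC → IsForcing H k TH → (∀ i → i ∈ TH → IsOriginal a X i) →
    ∃[ S ] (IsForcing G k S × ∣ S ∣ ≤ ∣ TC ∣ + ∣ TH ∣)
  upperBound {TC} {TH} (_ , tC , C⊆) (_ , tH , H⊆) only-originals =
    S , ((λ _ → ∈-tabulate⁺ refl) , t , G⊆) , size
    where
    S : Subset n
    S = preimage suc TC ∪ preimage (original a X) TH

    base : HatShadow TH S
    hat-shadow base {i} i∈TH with hatVertex a X i
    ... | original-vertex x =
      x∈p∪q⁺ (inj₂ (subst (_∈ preimage (original a X) TH) (sym (toG-original a X x)) (∈-preimage⁺ i∈TH)))
    ... | pendant-vertex x y = contradiction (only-originals _ i∈TH) (pendant-not-original a X)
    attached base p∈TH = contradiction (only-originals _ p∈TH) (pendant-not-original a X)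

    hat-simulated : ∃[ s ] HatShadow (𝓕 H k tH TH) (𝓕 G k s S)
    hat-simulated = 𝓕-simulation HatShadow 0 1 base hatShadow-step tH

    s₁ = proj₁ hat-simulated
    F₁ = 𝓕 G k s₁ S

    N[X]-coloured : ContractionShadow TC F₁
    contraction-shadow N[X]-coloured v∈TC = T⊆𝓕 G k s₁ (x∈p∪q⁺ (inj₁ (∈-preimage⁺ v∈TC)))
    X⊆ N[X]-coloured {x} x∈X =
      subst (_∈ F₁) (toG-original a X x) (hat-shadow (proj₂ hat-simulated) (H⊆ (original∈hat a X x∈X)))
    boundary⊆ N[X]-coloured {y} y∈B with ∈boundary⁻ a X y∈B
    ... | y∉X , x , x∈X , axy = subst (_∈ F₁) (toG-pendant a X x y)
      (hat-shadow (proj₂ hat-simulated) (H⊆ (pendant∈hat a X x∈X y∉X axy)))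

    contraction-simulated : ∃[ s ] ContractionShadow (𝓕 C k tC TC) (𝓕 G k s S)
    contraction-simulated = 𝓕-simulation ContractionShadow s₁ 1 N[X]-coloured contractionShadow-step tC

    t = proj₁ contraction-simulated

    G⊆ : vs G ⊆ 𝓕 G k t S
    G⊆ {v} _ with v ∈? X
    ... | yes v∈X = X⊆ (proj₂ contraction-simulated) v∈X
    ... | no  v∉X = contraction-shadow (proj₂ contraction-simulated) (C⊆ (outside∈contraction a X v∉X))

    size : ∣ S ∣ ≤ ∣ TC ∣ + ∣ TH ∣
    size = ≤-trans (∣p∪q∣≤∣p∣+∣q∣ (preimage suc TC) (preimage (original a X) TH)) 
      (+-mono-≤ (∣preimage∣≤ {q = TC} suc-injective) (∣preimage∣≤ {q = TH} (↑ˡ-injective (n * n) _ _)))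

module LowerBound (k : ℕ) {n} (a : Fin n → Fin n → Bool) (symmetric : ∀ u v → a u v ≡ a v u) (X : Subset n) where

  G = full a
  C = contraction a X
  B = boundary a X
  D = withoutFirst k B

  record Contracts (F : Subset n) (F' : Subset (suc n)) : Set where
    field
      outside-coloured  : ∀ {v} → v ∈ F → v ∉ X → suc v ∈ F'
      D-coloured        : ∀ {v} → v ∈ D → suc v ∈ F'
      vX-coloured       : ∀ {x} → x ∈ F → x ∈ X → zero ∈ F'
      boundary-coloured : ∀ {x b} → x ∈ F → x ∈ X → b ∈ B → suc b ∈ F'
  open Contracts

  uncoloured-vX≤k : ∀ {F'} → (∀ {v} → v ∈ D → suc v ∈ F') → ∣ N C zero ∩ ∁ F' ∣ ≤ k
  uncoloured-vX≤k {F'} D⊆F' = ≤-trans (p⊆q⇒∣p∣≤∣q∣ ⊆B─D) (∣p─withoutFirst∣≤k k B)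
    where
    ⊆B─D : N C zero ∩ ∁ F' ⊆ outside ∷ (B ─ D)
    ⊆B─D {zero}  u∈ with ∈N∩∁⁻ C {v = zero} u∈
    ... | () , _
    ⊆B─D {suc v} u∈ with ∈N∩∁⁻ C {v = zero} u∈
    ... | v∈B , v∉F' = there (x∈p∧x∉q⇒x∈p─q (∈-tabulate⁺ v∈B) (v∉F' ∘ D⊆F'))

  boundaryWitness : ∀ v → ∃[ x₀ ] (v ∈ B → x₀ ∈ X × a x₀ v ≡ true)
  boundaryWitness v with v ∈? B
  ... | yes v∈B = let (_ , x , x∈X , axv) = ∈boundary⁻ a X v∈B in x , λ _ → x∈X , axv
  ... | no  v∉B = v , λ v∈B → contradiction v∈B v∉B

  uncoloured-outside≤ : ∀ {F F' v} → Contracts F F' → ∣ N C (suc v) ∩ ∁ F' ∣ ≤ ∣ N G v ∩ ∁ F ∣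
  uncoloured-outside≤ {F} {F'} {v} c = ∣N∩∁∣≤-injection C G {v = suc v} {v' = v} f maps injective
    where
    x₀ = proj₁ (boundaryWitness v)
    x₀-adjacent = proj₂ (boundaryWitness v)

    f : Fin (suc n) → Fin n
    f zero    = x₀
    f (suc w) = w

    maps : ∀ {u} → adj C (suc v) u ≡ true → u ∉ F' → a v (f u) ≡ true × f u ∉ F
    maps {zero} v∈B vX∉F' with x₀-adjacent (∈-tabulate⁺ v∈B)
    ... | x₀∈X , ax₀v = trans (symmetric v x₀) ax₀v , λ x₀∈F → vX∉F' (vX-coloured c x₀∈F x₀∈X)
    maps {suc w} avw w∉F' with adj-contraction⁻ a X avw
    ... | _ , w∉X , avw' = avw' , λ w∈F → w∉F' (outside-coloured c w∈F w∉X)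

    injective : ∀ {u w} → adj C (suc v) u ≡ true → adj C (suc v) w ≡ true → f u ≡ f w → u ≡ w
    injective {zero}  {zero}  _   _   _    = refl
    injective {zero}  {suc w} v∈B avw refl =
      contradiction (proj₁ (x₀-adjacent (∈-tabulate⁺ v∈B))) (proj₁ (proj₂ (adj-contraction⁻ a X avw)))
    injective {suc u} {zero}  avu v∈B refl =
      contradiction (proj₁ (x₀-adjacent (∈-tabulate⁺ v∈B))) (proj₁ (proj₂ (adj-contraction⁻ a X avu)))
    injective {suc u} {suc w} _   _   u≡w  = cong suc u≡w

  contracts-step : ∀ {F F'} → Contracts F F' →
    Contracts (forceStep G k F) (forceStep C k (forceStep C k F'))
  contracts-step {F} {F'} c = record
    { outside-coloured  = outside-coloured′
    ; D-coloured        = twice ∘ D-coloured c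
    ; vX-coloured       = λ x∈ x∈X → F⊆forceStep C k (vX-coloured′ x∈ x∈X)
    ; boundary-coloured = λ x∈ x∈X b∈B →
        forceStep-forces C k (vX-coloured′ x∈ x∈X , uncoloured-vX≤k (F⊆forceStep C k ∘ D-coloured c))
          (∈-tabulate⁻ b∈B)
    }
    where
    twice : F' ⊆ forceStep C k (forceStep C k F')
    twice = F⊆forceStep C k ∘ F⊆forceStep C k

    outside-forces : ∀ {u w} → u ∈ F → u ∉ X → ∣ N G u ∩ ∁ F ∣ ≤ k →
      adj C (suc u) w ≡ true → w ∈ forceStep C k F'
    outside-forces u∈F u∉X few =
      forceStep-forces C k (outside-coloured c u∈F u∉X , ≤-trans (uncoloured-outside≤ c) few)

    vX-coloured′ : ∀ {x} → x ∈ forceStep G k F → x ∈ X → zero ∈ forceStep C k F'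
    vX-coloured′ x∈ x∈X with forceStep⁻ G k x∈
    ... | inj₁ x∈F = F⊆forceStep C k (vX-coloured c x∈F x∈X)
    ... | inj₂ (u , (u∈F , few) , aux) with u ∈? X
    ...   | yes u∈X = F⊆forceStep C k (vX-coloured c u∈F u∈X)
    ...   | no  u∉X = outside-forces u∈F u∉X few
                        (∈-tabulate⁻ (∈boundary⁺ a X u∉X x∈X (trans (symmetric _ u) aux)))

    outside-coloured′ : ∀ {v} → v ∈ forceStep G k F → v ∉ X → suc v ∈ forceStep C k (forceStep C k F')
    outside-coloured′ v∈ v∉X with forceStep⁻ G k v∈
    ... | inj₁ v∈F = twice (outside-coloured c v∈F v∉X)
    ... | inj₂ (u , (u∈F , few) , auv) with u ∈? X
    ...   | yes u∈X = twice (boundary-coloured c u∈F u∈X (∈boundary⁺ a X v∉X u∈X auv))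
    ...   | no  u∉X = F⊆forceStep C k (outside-forces u∈F u∉X few (adj-contraction⁺ a X u∉X v∉X auv))

  seed : Subset n → Bool → Subset (suc n)
  seed T h = h ∷ ((T ─ X) ∪ D)

  vX∈seed : ∀ {T h} → h ≡ true → zero ∈ seed T h
  vX∈seed refl = here

  D⊆seed : ∀ {T h v} → v ∈ D → suc v ∈ seed T h
  D⊆seed v∈D = there (x∈p∪q⁺ (inj₂ v∈D))

  seed⊆ : ∀ {T h} → seed T h ⊆ vs C
  seed⊆ {x = zero}  _           = here
  seed⊆ {T} {x = suc v} (there v∈) with x∈p∪q⁻ (T ─ X) D v∈
  ... | inj₁ v∈T─X = outside∈contraction a X (x∈p─q⇒x∉q v∈T─X)
  ... | inj₂ v∈D   = outside∈contraction a X (proj₁ (∈boundary⁻ a X (withoutFirst⊆ k B v∈D)))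

  contracts-seed : ∀ {T h} → (Nonempty (T ∩ X) → h ≡ true) → Contracts T (forceStep C k (seed T h))
  contracts-seed {T} {h} meets⇒h = record
    { outside-coloured  = λ v∈T v∉X → F⊆forceStep C k (there (x∈p∪q⁺ (inj₁ (x∈p∧x∉q⇒x∈p─q v∈T v∉X))))
    ; D-coloured        = F⊆forceStep C k ∘ D⊆seed {T} {h}
    ; vX-coloured       = λ x∈T x∈X → F⊆forceStep C k (vX∈seed (h-true x∈T x∈X))
    ; boundary-coloured = λ x∈T x∈X b∈B →
        forceStep-forces C k (vX∈seed (h-true x∈T x∈X) , uncoloured-vX≤k (D⊆seed {T} {h})) (∈-tabulate⁻ b∈B)
    }
    where
    h-true : ∀ {x} → x ∈ T → x ∈ X → h ≡ true
    h-true x∈T x∈X = meets⇒h (_ , x∈p∩q⁺ (x∈T , x∈X))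

  seed-forcing : ∀ {T h} → IsForcing G k T → (Nonempty (T ∩ X) → h ≡ true) → (Empty X → h ≡ true) →
    IsForcing C k (seed T h)
  seed-forcing {T} {h} (_ , t , G⊆) meets⇒h empty⇒h = seed⊆ , s , C⊆
    where
    simulated : ∃[ s ] Contracts (𝓕 G k t T) (𝓕 C k s (seed T h))
    simulated = 𝓕-simulation Contracts 1 2 (contracts-seed meets⇒h) contracts-step t

    s = proj₁ simulated

    coloured : ∀ v → v ∈ 𝓕 G k t T
    coloured v = G⊆ (∈-tabulate⁺ refl)

    C⊆ : vs C ⊆ 𝓕 C k s (seed T h)
    C⊆ {zero} _ with nonempty? X
    ... | yes (x , x∈X) = vX-coloured (proj₂ simulated) (coloured x) x∈X
    ... | no  X≡∅ = T⊆𝓕 C k s (vX∈seed (empty⇒h X≡∅))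
    C⊆ {suc v} v∈ = outside-coloured (proj₂ simulated) (coloured v) (outside∈contraction⁻ a X v∈)

  ∣seed∣≤ : ∀ T h → ∣ seed T h ∣ ≤ suc (∣ T ∣ + ∣ D ∣)
  ∣seed∣≤ T h = ≤-trans (∣h∷p∣≤1+∣p∣ h) (s≤s (≤-trans (∣p∪q∣≤∣p∣+∣q∣ (T ─ X) D) (+-monoˡ-≤ ∣ D ∣ (∣p─q∣≤∣p∣ T X))))
    where
    ∣h∷p∣≤1+∣p∣ : ∀ h → ∣ h ∷ ((T ─ X) ∪ D) ∣ ≤ suc ∣ (T ─ X) ∪ D ∣
    ∣h∷p∣≤1+∣p∣ false = n≤1+n _
    ∣h∷p∣≤1+∣p∣ true  = ≤-refl

  ∣seed∣≤-sharp : ∀ T h → (h ≡ true → Nonempty (T ∩ X)) → ∣ seed T h ∣ ≤ ∣ T ∣ + ∣ D ∣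
  ∣seed∣≤-sharp T false _     = ≤-trans (∣p∪q∣≤∣p∣+∣q∣ (T ─ X) D) (+-monoˡ-≤ ∣ D ∣ (∣p─q∣≤∣p∣ T X))
  ∣seed∣≤-sharp T true  meets =
    ≤-trans (s≤s (∣p∪q∣≤∣p∣+∣q∣ (T ─ X) D)) (+-monoˡ-≤ ∣ D ∣ (p∩q≢∅⇒∣p─q∣<∣p∣ T X (meets refl)))

  lowerBound : ∀ {T} → IsForcing G k T →
    ∃[ T' ] (IsForcing C k T' × ∣ T' ∣ ≤ suc (∣ T ∣ + ∣ D ∣) × (Nonempty X → ∣ T' ∣ ≤ ∣ T ∣ + ∣ D ∣))
  lowerBound {T} forcing with nonempty? X | nonempty? (T ∩ X)
  ... | no X≡∅ | _ =
    seed T true , seed-forcing forcing (λ _ → refl) (λ _ → refl) , ∣seed∣≤ T true , λ X≢∅ → contradiction X≢∅ X≡∅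
  ... | yes _ | yes meets =
    seed T true , seed-forcing forcing (λ _ → refl) (λ _ → refl) , ∣seed∣≤ T true , λ _ → ∣seed∣≤-sharp T true λ _ → meets
  ... | yes X≢∅ | no misses =
    seed T false , seed-forcing forcing (λ meets → contradiction meets misses) (λ X≡∅ → contradiction X≢∅ X≡∅) ,
    ∣seed∣≤ T false , λ _ → ∣seed∣≤-sharp T false λ ()

  lowerBound-small : ∀ {T} → IsForcing G k T → ∣ B ∣ ≤ k → ∃[ T' ] (IsForcing C k T' × ∣ T' ∣ ≤ ∣ T ∣ + 1)
  lowerBound-small {T} forcing small with lowerBound forcing
  ... | T' , T'-forcing , T'-size , _ = T' , T'-forcing , (begin
    ∣ T' ∣               ≤⟨ T'-size ⟩
    suc (∣ T ∣ + ∣ D ∣)  ≤⟨ s≤s (+-monoʳ-≤ ∣ T ∣ ∣D∣≤0) ⟩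
    suc (∣ T ∣ + 0)      ≡⟨ cong suc (+-identityʳ ∣ T ∣) ⟩
    suc ∣ T ∣            ≡⟨ +-comm 1 ∣ T ∣ ⟩
    ∣ T ∣ + 1            ∎)
    where
    open ≤-Reasoning
    ∣D∣≤0 : ∣ D ∣ ≤ 0
    ∣D∣≤0 = ≤-trans (∣withoutFirst∣≤∣p∣∸k k B) (≤-reflexive (m≤n⇒m∸n≡0 small))

  lowerBound-large : ∀ {T} → IsForcing G k T → ∣ B ∣ > k → ∃[ T' ] (IsForcing C k T' × ∣ T' ∣ + k ≤ ∣ T ∣ + ∣ B ∣)
  lowerBound-large {T} forcing large with lowerBound forcing
  ... | T' , T'-forcing , _ , T'-size = T' , T'-forcing , (begin
    ∣ T' ∣ + k               ≤⟨ +-monoˡ-≤ k (T'-size X≢∅) ⟩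
    ∣ T ∣ + ∣ D ∣ + k        ≤⟨ +-monoˡ-≤ k (+-monoʳ-≤ ∣ T ∣ (∣withoutFirst∣≤∣p∣∸k k B)) ⟩
    ∣ T ∣ + (∣ B ∣ ∸ k) + k  ≡⟨ +-assoc ∣ T ∣ (∣ B ∣ ∸ k) k ⟩
    ∣ T ∣ + (∣ B ∣ ∸ k + k)  ≡⟨ cong (∣ T ∣ +_) (m∸n+n≡m (<⇒≤ large)) ⟩
    ∣ T ∣ + ∣ B ∣            ∎)
    where
    open ≤-Reasoning
    X≢∅ : Nonempty X
    X≢∅ = boundary-nonempty⇒X-nonempty a X (∣p∣>0⇒Nonempty B (≤-trans (s≤s z≤n) large))

proposition4p14 : (k n : ℕ) (a : Fin n → Fin n → Bool) → IsSimple a → Connected a →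
    (X : Subset n) →
    (∃[ T ] (IsMinForcing (hat a X) k T × (∀ i → i ∈ T → IsOriginal a X i))) →
    (zG zC zH : ℕ) → IsZ (full a) k zG → IsZ (contraction a X) k zC → IsZ (hat a X) k zH →
    (zG ≤ zC + zH)
    × (∣ boundary a X ∣ ≤ k → zC ≤ zG + 1)
    × (∣ boundary a X ∣ > k → zC + k ≤ zG + ∣ boundary a X ∣)
proposition4p14 k n a (symmetric , _) _ X (TH , (TH-forcing , TH-min) , only-originals) _ _ _
  (TG , (TG-forcing , TG-min) , refl) (TC , (TC-forcing , TC-min) , refl) (TH₀ , (TH₀-forcing , _) , refl) =
  upper , lower-small , lower-large
  where
  upper : ∣ TG ∣ ≤ ∣ TC ∣ + ∣ TH₀ ∣
  upper with UpperBound.upperBound k a X TC-forcing TH-forcing only-originals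
  ... | S , S-forcing , S-size =
    ≤-trans (TG-min S S-forcing) (≤-trans S-size (+-monoʳ-≤ ∣ TC ∣ (TH-min TH₀ TH₀-forcing)))

  lower-small : ∣ boundary a X ∣ ≤ k → ∣ TC ∣ ≤ ∣ TG ∣ + 1
  lower-small small with LowerBound.lowerBound-small k a symmetric X TG-forcing small
  ... | T' , T'-forcing , T'-size = ≤-trans (TC-min T' T'-forcing) T'-size

  lower-large : ∣ boundary a X ∣ > k → ∣ TC ∣ + k ≤ ∣ TG ∣ + ∣ boundary a X ∣
  lower-large large with LowerBound.lowerBound-large k a symmetric X TG-forcing large
  ... | T' , T'-forcing , T'-size = ≤-trans (+-monoˡ-≤ k (TC-min T' T'-forcing)) T'-size
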